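{- Let $G$ be a semi-cubic bipartite graph with bipartition $(X,Y)$. If $|X|\ge 3$ and $|Y|\ge 2|X|-4$, then $G$ has a subgraph $H$ such that either (i) $H$ is a $K_{3,2}$-subgraph of $G$, or (ii) $H$ is $3$-connected and there is a vertex $h\in V(H)\cap Y$ such that $H-h$ is internally $3$-connected.
   Context: All graphs are finite and simple. A bipartite graph with bipartition $(X,Y)$ is semi-cubic if $d_G(y)=3$ for all $y\in Y$. For a bipartite graph with fixed bipartition $(X,Y)$, a $K_{s,t}$-subgraph is a subgraph $H$ isomorphic to $K_{s,t}$ with $|V(H)\cap X|=s$ and $|V(H)\cap Y|=t$. A graph is $3$-connected if it has more than $3$ vertices and no vertex cut of size less than $3$. A $2$-separation of a graph $G$ is a pair $\{G_1,G_2\}$ of edge-disjoint subgraphs with $G_1\cup G_2=G$, $|V(G_1)\cap V(G_2)|=2$ and $\min\{|V(G_1)|,|V(G_2)|\}\ge 3$ (isolated vertices allowed). A $2$-connected graph with at least four vertices is internally $3$-connected if for every $2$-separation $\{G_1,G_2\}$ one of $G_1,G_2$ is isomorphic to the $3$-vertex path $P_3$. -}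

module Defs where

open import Data.Bool using (Bool; true; false; _∧_; _∨_; not)
open import Data.Nat using (ℕ; _+_; _*_; _≤_; _<_)
open import Data.Fin using (Fin)
open import Data.Fin.Subset using (Subset; _∈_; _⊆_; _∪_; _∩_; _─_; ∣_∣; ⁅_⁆; ⊥; ⊤)
open import Data.Vec using (lookup; tabulate)
open import Data.Sum using (_⊎_; inj₁; inj₂)
open import Data.Product using (_×_; Σ; ∃; ∃-syntax)
open import Data.Empty renaming (⊥ to Empty)
open import Relation.Binary.PropositionalEquality using (_≡_; _≢_)
open import Relation.Nullary using (¬_)

-- A bipartite graph G with bipartition (X,Y) is given by |X| = a,
-- |Y| = b, X = Fin a, Y = Fin b, and an edge relation
-- E : Fin a → Fin b → Bool (E x y ≡ true iff xy is an edge).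
-- Such a graph is automatically finite and simple, and every edge
-- goes between X and Y.
--
-- Subgraphs of G (and the graphs derived from them by deleting
-- vertices, and the pieces of 2-separations) are all represented as
-- "bipartite structures" on the same vertex universe X ⊎ Y: a vertex
-- subset of X, a vertex subset of Y and a set of X–Y edges.

record BGraph (a b : ℕ) : Set where
  constructor mkBG
  field
    vx : Subset a
    vy : Subset b
    ed : Fin a → Fin b → Bool
open BGraph public

Vtx : ℕ → ℕ → Set
Vtx a b = Fin a ⊎ Fin b

whole : ∀ {a b} → (Fin a → Fin b → Bool) → BGraph a b
whole E = mkBG ⊤ ⊤ E

WellFormed : ∀ {a b} → BGraph a b → Set
WellFormed H = ∀ x y → ed H x y ≡ true → (x ∈ vx H) × (y ∈ vy H)

SubgraphOf : ∀ {a b} → BGraph a b → BGraph a b → Set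
SubgraphOf H K = WellFormed H × (vx H ⊆ vx K) × (vy H ⊆ vy K)
               × (∀ x y → ed H x y ≡ true → ed K x y ≡ true)

nV : ∀ {a b} → BGraph a b → ℕ
nV H = ∣ vx H ∣ + ∣ vy H ∣

InV : ∀ {a b} → BGraph a b → Vtx a b → Set
InV H (inj₁ x) = x ∈ vx H
InV H (inj₂ y) = y ∈ vy H

Adj : ∀ {a b} → BGraph a b → Vtx a b → Vtx a b → Set
Adj H (inj₁ x) (inj₂ y) = ed H x y ≡ true
Adj H (inj₂ y) (inj₁ x) = ed H x y ≡ true
Adj H (inj₁ _) (inj₁ _) = Empty
Adj H (inj₂ _) (inj₂ _) = Empty

data Reach {a b} (H : BGraph a b) : Vtx a b → Vtx a b → Set where
  here : ∀ {u} → InV H u → Reach H u u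
  step : ∀ {u v w} → Adj H u v → Reach H v w → Reach H u w

Connected : ∀ {a b} → BGraph a b → Set
Connected H = ∀ u v → InV H u → InV H v → Reach H u v

delete : ∀ {a b} → BGraph a b → Subset a → Subset b → BGraph a b
delete H SX SY = mkBG (vx H ─ SX) (vy H ─ SY)
  (λ x y → ed H x y ∧ not (lookup SX x) ∧ not (lookup SY y))

deleteY : ∀ {a b} → BGraph a b → Fin b → BGraph a b
deleteY H h = delete H ⊥ ⁅ h ⁆

KConnected : ℕ → ∀ {a b} → BGraph a b → Set
KConnected k H = (k < nV H) ×
  (∀ SX SY → SX ⊆ vx H → SY ⊆ vy H → ∣ SX ∣ + ∣ SY ∣ < k →
     Connected (delete H SX SY))

TwoSeparation : ∀ {a b} → BGraph a b → BGraph a b → BGraph a b → Set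
TwoSeparation K G₁ G₂ =
  SubgraphOf G₁ K × SubgraphOf G₂ K
  × (∀ x y → ¬ (ed G₁ x y ≡ true × ed G₂ x y ≡ true))
  × (vx G₁ ∪ vx G₂ ≡ vx K) × (vy G₁ ∪ vy G₂ ≡ vy K)
  × (∀ x y → ed K x y ≡ ed G₁ x y ∨ ed G₂ x y)
  × (∣ vx G₁ ∩ vx G₂ ∣ + ∣ vy G₁ ∩ vy G₂ ∣ ≡ 2)
  × (3 ≤ nV G₁) × (3 ≤ nV G₂)

SamePair : ∀ {a b} → Vtx a b → Vtx a b → Vtx a b → Vtx a b → Set
SamePair z z' p q = (z ≡ p × z' ≡ q) ⊎ (z ≡ q × z' ≡ p)

IsP3 : ∀ {a b} → BGraph a b → Set
IsP3 {a} {b} H = ∃[ u ] ∃[ v ] ∃[ w ] (u ≢ v × v ≢ w × u ≢ w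
  × (∀ z → (InV H z → (z ≡ u ⊎ z ≡ v ⊎ z ≡ w))
         × ((z ≡ u ⊎ z ≡ v ⊎ z ≡ w) → InV H z))
  × (∀ z z' → (Adj H z z' → (SamePair z z' u v ⊎ SamePair z z' v w))
            × ((SamePair z z' u v ⊎ SamePair z z' v w) → Adj H z z')))

InternallyThreeConnected : ∀ {a b} → BGraph a b → Set
InternallyThreeConnected K = KConnected 2 K × (4 ≤ nV K)
  × (∀ G₁ G₂ → TwoSeparation K G₁ G₂ → IsP3 G₁ ⊎ IsP3 G₂)

IsK32 : ∀ {a b} → BGraph a b → Set
IsK32 {a} {b} H = ∃[ x₁ ] ∃[ x₂ ] ∃[ x₃ ] ∃[ y₁ ] ∃[ y₂ ]
  (x₁ ≢ x₂ × x₂ ≢ x₃ × x₁ ≢ x₃ × y₁ ≢ y₂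
  × (∀ x → (x ∈ vx H → (x ≡ x₁ ⊎ x ≡ x₂ ⊎ x ≡ x₃))
         × ((x ≡ x₁ ⊎ x ≡ x₂ ⊎ x ≡ x₃) → x ∈ vx H))
  × (∀ y → (y ∈ vy H → (y ≡ y₁ ⊎ y ≡ y₂))
         × ((y ≡ y₁ ⊎ y ≡ y₂) → y ∈ vy H))
  × (∀ x y → x ∈ vx H → y ∈ vy H → ed H x y ≡ true))

SemiCubic : ∀ {a b} → (Fin a → Fin b → Bool) → Set
SemiCubic {a} {b} E = ∀ (y : Fin b) → ∣ tabulate (λ x → E x y) ∣ ≡ 3

-- Two vertices of Y with the same three neighbours span a K₃,₂, so assume there are no such twins.
-- Call Z ⊆ Y c-tight when 2|N(Z)| ≤ c + |Z|. The hypothesis makes Y itself 4-tight, so some nonempty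
-- Y′ ⊆ Y is 4-tight while every nonempty proper subset Z of Y′ expands: 2|N(Z)| ≥ |Z| + 5. Let H be
-- the subgraph induced by Y′ ∪ N(Y′) and h ∈ Y′; minimality and twin-freeness give every x ∈ N(Y′)
-- at least three neighbours in Y′. If deleting S separates H (c = 4) or H − h (c = 5), the Y-vertices
-- left split into two closed parts whose neighbourhoods meet only in S; adding their expansion
-- inequalities and comparing with c-tightness gives 10 ≤ c + 2|S|, which rules out |S| ≤ 2 in H and
-- |S| ≤ 1 in H − h. The same count shows that one side of a 2-separation of H − h has no Y-vertex of
-- its own; that side is a single X-vertex joined to the two separating vertices, a P₃.

module Submission where

open import Defs
open import Data.Bool using (Bool; true; false; _∧_; _∨_; not)
open import Data.Bool.Properties using (∨-comm)
open import Data.Nat using (ℕ; zero; suc; _+_; _*_; _≤_; _<_; z≤n; s≤s; _≤?_; _<?_)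
open import Data.Nat.Properties hiding (_≟_)
open import Data.Fin using (Fin; _≟_)
open import Data.Fin.Properties using (any?)
open import Data.Fin.Subset
open import Data.Fin.Subset.Properties
open import Data.Vec using ([]; _∷_; here; there; lookup; tabulate)
open import Data.Vec.Properties using ([]=⇒lookup; lookup⇒[]=; lookup∘tabulate; ≡-dec)
open import Data.Sum using (_⊎_; inj₁; inj₂; [_,_]; [_,_]′)
open import Data.Sum.Properties using (inj₂-injective)
open import Data.Product using (_×_; _,_; ∃; ∃-syntax; proj₁; proj₂; map₂)
open import Function using (_∘_)
open import Data.Empty using (⊥-elim) renaming (⊥ to False)
open import Relation.Binary.PropositionalEquality using (_≡_; _≢_; refl; sym; trans; cong; cong₂; subst)
open import Relation.Nullary using (¬_; Dec; yes; no; does)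
open import Relation.Nullary.Decidable using (_×-dec_; ¬?; dec-true; from-yes; decidable-stable)
open import Data.Nat.Tactic.RingSolver using (solve-∀)

private variable
  k n : ℕ
  p q : Subset n
  x y : Fin n

x∈p─q⁻ : ∀ (p q : Subset n) → x ∈ p ─ q → x ∈ p × x ∉ q
x∈p─q⁻ p q x∈p─q = p─q⊆p p q x∈p─q , x∉q p q x∈p─q
  where
  x∉q : ∀ {n} {x : Fin n} (p q : Subset n) → x ∈ p ─ q → x ∉ q
  x∉q (_ ∷ p) (_ ∷ q) (there x∈) (there x∈q) = x∉q p q x∈ x∈q

x∈p-y⁻ : ∀ (p : Subset n) → x ∈ p - y → x ∈ p × x ≢ y
x∈p-y⁻ {y = y} p x∈ = map₂ x∉⁅y⁆⇒x≢y (x∈p─q⁻ p ⁅ y ⁆ x∈)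

⊆⊎∃∉ : ∀ (p q : Subset n) → p ⊆ q ⊎ ∃ λ x → x ∈ p × x ∉ q
⊆⊎∃∉ p q with nonempty? (p ─ q)
... | yes (x , x∈p─q) = inj₂ (x , x∈p─q⁻ p q x∈p─q)
... | no empty = inj₁ λ {x} x∈p →
  decidable-stable (x ∈? q) λ x∉q → empty (x , x∈p∧x∉q⇒x∈p─q x∈p x∉q)

∣p∪q∣+∣p∩q∣≡∣p∣+∣q∣ : ∀ (p q : Subset n) → ∣ p ∪ q ∣ + ∣ p ∩ q ∣ ≡ ∣ p ∣ + ∣ q ∣
∣p∪q∣+∣p∩q∣≡∣p∣+∣q∣ [] [] = refl
∣p∪q∣+∣p∩q∣≡∣p∣+∣q∣ (inside ∷ p) (inside ∷ q) =
  cong suc (trans (+-suc _ _) (trans (cong suc (∣p∪q∣+∣p∩q∣≡∣p∣+∣q∣ p q)) (sym (+-suc _ _))))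
∣p∪q∣+∣p∩q∣≡∣p∣+∣q∣ (inside ∷ p) (outside ∷ q) = cong suc (∣p∪q∣+∣p∩q∣≡∣p∣+∣q∣ p q)
∣p∪q∣+∣p∩q∣≡∣p∣+∣q∣ (outside ∷ p) (inside ∷ q) =
  trans (cong suc (∣p∪q∣+∣p∩q∣≡∣p∣+∣q∣ p q)) (sym (+-suc _ _))
∣p∪q∣+∣p∩q∣≡∣p∣+∣q∣ (outside ∷ p) (outside ∷ q) = ∣p∪q∣+∣p∩q∣≡∣p∣+∣q∣ p q

∣p∪q∣≤∣p∣+∣q∣ : ∀ (p q : Subset n) → ∣ p ∪ q ∣ ≤ ∣ p ∣ + ∣ q ∣
∣p∪q∣≤∣p∣+∣q∣ p q = ≤-trans (m≤m+n _ _) (≤-reflexive (∣p∪q∣+∣p∩q∣≡∣p∣+∣q∣ p q))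

x∈p⇒∣p∣≡suc∣p-x∣ : ∀ (p : Subset n) → x ∈ p → ∣ p ∣ ≡ suc ∣ p - x ∣
x∈p⇒∣p∣≡suc∣p-x∣ (inside ∷ p) here = cong (suc ∘ ∣_∣) (sym (p─⊥≡p p))
x∈p⇒∣p∣≡suc∣p-x∣ (inside ∷ p) (there x∈p) = cong suc (x∈p⇒∣p∣≡suc∣p-x∣ p x∈p)
x∈p⇒∣p∣≡suc∣p-x∣ (outside ∷ p) (there x∈p) = x∈p⇒∣p∣≡suc∣p-x∣ p x∈p

x∈p⇒1≤∣p∣ : x ∈ p → 1 ≤ ∣ p ∣
x∈p⇒1≤∣p∣ {x = x} {p = p} x∈p = subst (_≤ ∣ p ∣) (∣⁅x⁆∣≡1 x)
  (p⊆q⇒∣p∣≤∣q∣ λ y∈⁅x⁆ → subst (_∈ p) (sym (x∈⁅y⁆⇒x≡y x y∈⁅x⁆)) x∈p)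

1≤∣p∣⇒Nonempty : ∀ {n} {p : Subset n} → 1 ≤ ∣ p ∣ → Nonempty p
1≤∣p∣⇒Nonempty {n = n} {p = p} 1≤∣p∣ with nonempty? p
... | yes ne = ne
... | no empty = ⊥-elim (<⇒≱ 1≤∣p∣ (≤-reflexive (trans (cong ∣_∣ (Empty-unique empty)) (∣⊥∣≡0 n))))

∣p∣≡suc⇒∃ : ∀ (p : Subset n) → ∣ p ∣ ≡ suc k → ∃ λ x → x ∈ p × ∣ p - x ∣ ≡ k
∣p∣≡suc⇒∃ p ∣p∣≡1+k with 1≤∣p∣⇒Nonempty {p = p} (≤-trans (s≤s z≤n) (≤-reflexive (sym ∣p∣≡1+k)))
... | x , x∈p = x , x∈p , suc-injective (trans (sym (x∈p⇒∣p∣≡suc∣p-x∣ p x∈p)) ∣p∣≡1+k)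

two-elements⇒2≤∣p∣ : x ∈ p → y ∈ p → x ≢ y → 2 ≤ ∣ p ∣
two-elements⇒2≤∣p∣ x∈p y∈p x≢y =
  ≤-trans (s≤s (x∈p⇒1≤∣p∣ (x∈p∧x≢y⇒x∈p-y y∈p (x≢y ∘ sym)))) (x∈p⇒∣p-x∣<∣p∣ x∈p)

two-elements-exhaust : ∀ {z} → ∣ p ∣ ≤ 2 → x ∈ p → y ∈ p → x ≢ y → z ∈ p → z ≡ x ⊎ z ≡ y
two-elements-exhaust {p = p} {x = x} {y} {z} ∣p∣≤2 x∈p y∈p x≢y z∈p with z ≟ x | z ≟ y
... | yes z≡x | _ = inj₁ z≡x
... | no _ | yes z≡y = inj₂ z≡y
... | no z≢x | no z≢y = ⊥-elim (<⇒≱ (s≤s ≤-refl) (begin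
  3               ≤⟨ s≤s (two-elements⇒2≤∣p∣ (x∈p∧x≢y⇒x∈p-y y∈p (x≢y ∘ sym)) (x∈p∧x≢y⇒x∈p-y z∈p z≢x) (z≢y ∘ sym)) ⟩
  suc ∣ p - x ∣   ≡⟨ sym (x∈p⇒∣p∣≡suc∣p-x∣ p x∈p) ⟩
  ∣ p ∣           ≤⟨ ∣p∣≤2 ⟩
  2               ∎))
  where open ≤-Reasoning

x∈⁅y⁆∪⁅z⁆⁺ : ∀ {z} → x ≡ y ⊎ x ≡ z → x ∈ ⁅ y ⁆ ∪ ⁅ z ⁆
x∈⁅y⁆∪⁅z⁆⁺ (inj₁ refl) = x∈p∪q⁺ (inj₁ (x∈⁅x⁆ _))
x∈⁅y⁆∪⁅z⁆⁺ (inj₂ refl) = x∈p∪q⁺ (inj₂ (x∈⁅x⁆ _))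

x∈⁅y⁆∪⁅z⁆⁻ : ∀ {z} → x ∈ ⁅ y ⁆ ∪ ⁅ z ⁆ → x ≡ y ⊎ x ≡ z
x∈⁅y⁆∪⁅z⁆⁻ {y = y} {z} x∈ = Data.Sum.map (x∈⁅y⁆⇒x≡y y) (x∈⁅y⁆⇒x≡y z) (x∈p∪q⁻ ⁅ y ⁆ ⁅ z ⁆ x∈)

∣⁅y⁆∪⁅z⁆∣≤2 : ∀ (y z : Fin n) → ∣ ⁅ y ⁆ ∪ ⁅ z ⁆ ∣ ≤ 2
∣⁅y⁆∪⁅z⁆∣≤2 y z = ≤-trans (∣p∪q∣≤∣p∣+∣q∣ ⁅ y ⁆ ⁅ z ⁆) (≤-reflexive (cong₂ _+_ (∣⁅x⁆∣≡1 y) (∣⁅x⁆∣≡1 z)))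

⊆∧∣⊇∣⇒≡ : p ⊆ q → ∣ q ∣ ≤ ∣ p ∣ → p ≡ q
⊆∧∣⊇∣⇒≡ {p = p} {q = q} p⊆q ∣q∣≤∣p∣ with ⊆⊎∃∉ q p
... | inj₁ q⊆p = ⊆-antisym p⊆q q⊆p
... | inj₂ (x , x∈q , x∉p) = ⊥-elim (<⇒≱ (p⊂q⇒∣p∣<∣q∣ (p⊆q , x , x∈q , x∉p)) ∣q∣≤∣p∣)

∣p∩q∣≤suc∣p∩q-y∣ : ∀ (p q : Subset n) y → ∣ p ∩ q ∣ ≤ suc ∣ p ∩ (q - y) ∣
∣p∩q∣≤suc∣p∩q-y∣ p q y = begin
  ∣ p ∩ q ∣                    ≤⟨ p⊆q⇒∣p∣≤∣q∣ split ⟩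
  ∣ p ∩ (q - y) ∪ ⁅ y ⁆ ∣      ≤⟨ ∣p∪q∣≤∣p∣+∣q∣ (p ∩ (q - y)) ⁅ y ⁆ ⟩
  ∣ p ∩ (q - y) ∣ + ∣ ⁅ y ⁆ ∣  ≡⟨ cong (∣ p ∩ (q - y) ∣ +_) (∣⁅x⁆∣≡1 y) ⟩
  ∣ p ∩ (q - y) ∣ + 1          ≡⟨ +-comm _ 1 ⟩
  suc ∣ p ∩ (q - y) ∣          ∎
  where
  open ≤-Reasoning
  split : p ∩ q ⊆ p ∩ (q - y) ∪ ⁅ y ⁆
  split {z} z∈p∩q with z ≟ y | x∈p∩q⁻ p q z∈p∩q
  ... | yes refl | _ = x∈p∪q⁺ (inj₂ (x∈⁅x⁆ z))
  ... | no z≢y | z∈p , z∈q = x∈p∪q⁺ (inj₁ (x∈p∩q⁺ (z∈p , x∈p∧x≢y⇒x∈p-y z∈q z≢y)))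

∣p∣≡3⇒enumerate : ∀ (p : Subset n) → ∣ p ∣ ≡ 3 → ∃ λ x₁ → ∃ λ x₂ → ∃ λ x₃ →
  x₁ ≢ x₂ × x₂ ≢ x₃ × x₁ ≢ x₃ × x₁ ∈ p × x₂ ∈ p × x₃ ∈ p × (∀ {x} → x ∈ p → x ≡ x₁ ⊎ x ≡ x₂ ⊎ x ≡ x₃)
∣p∣≡3⇒enumerate p ∣p∣≡3
  with ∣p∣≡suc⇒∃ p ∣p∣≡3
... | x₁ , x₁∈p , ∣p₁∣≡2 with ∣p∣≡suc⇒∃ (p - x₁) ∣p₁∣≡2
... | x₂ , x₂∈p₁ , ∣p₂∣≡1 with ∣p∣≡suc⇒∃ (p - x₁ - x₂) ∣p₂∣≡1
... | x₃ , x₃∈p₂ , ∣p₃∣≡0 =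
  x₁ , x₂ , x₃ , x₂≢x₁ ∘ sym , x₃≢x₂ ∘ sym , x₃≢x₁ ∘ sym ,
  x₁∈p , proj₁ (x∈p-y⁻ p x₂∈p₁) , proj₁ (x∈p-y⁻ p x₃∈p₁) , exhaust
  where
  x₂≢x₁ = proj₂ (x∈p-y⁻ p x₂∈p₁)
  x₃∈p₁ = proj₁ (x∈p-y⁻ (p - x₁) x₃∈p₂)
  x₃≢x₂ = proj₂ (x∈p-y⁻ (p - x₁) x₃∈p₂)
  x₃≢x₁ = proj₂ (x∈p-y⁻ p x₃∈p₁)
  exhaust : ∀ {x} → x ∈ p → x ≡ x₁ ⊎ x ≡ x₂ ⊎ x ≡ x₃
  exhaust {x} x∈p with x ≟ x₁ | x ≟ x₂ | x ≟ x₃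
  ... | yes x≡x₁ | _ | _ = inj₁ x≡x₁
  ... | no _ | yes x≡x₂ | _ = inj₂ (inj₁ x≡x₂)
  ... | no _ | no _ | yes x≡x₃ = inj₂ (inj₂ x≡x₃)
  ... | no x≢x₁ | no x≢x₂ | no x≢x₃ = ⊥-elim (<⇒≱
    (x∈p⇒1≤∣p∣ (x∈p∧x≢y⇒x∈p-y (x∈p∧x≢y⇒x∈p-y (x∈p∧x≢y⇒x∈p-y x∈p x≢x₁) x≢x₂) x≢x₃))
    (≤-reflexive ∣p₃∣≡0))

2*n≢7 : ∀ n → 2 * n ≢ 7
2*n≢7 n 2n≡7 = <⇒≱ 3<n n≤3
  where
  3<n : 3 < n
  3<n = *-cancelˡ-< 2 3 n (≤-reflexive (sym 2n≡7))
  n≤3 : n ≤ 3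
  n≤3 = ≤-pred (*-cancelˡ-< 2 n 4 (s≤s (≤-reflexive 2n≡7)))

∈-tabulate⁺ : ∀ {f : Fin n → Bool} → f x ≡ true → x ∈ tabulate f
∈-tabulate⁺ {x = x} {f} fx≡true = lookup⇒[]= x (tabulate f) (trans (lookup∘tabulate f x) fx≡true)

∈-tabulate⁻ : ∀ {f : Fin n → Bool} → x ∈ tabulate f → f x ≡ true
∈-tabulate⁻ {x = x} {f} x∈ = trans (sym (lookup∘tabulate f x)) ([]=⇒lookup x∈)

∉⇒not-lookup : x ∉ p → not (lookup p x) ≡ true
∉⇒not-lookup {x = x} {p = p} x∉p with lookup p x in eq
... | true = ⊥-elim (x∉p (lookup⇒[]= x p eq))
... | false = refl

not-lookup⇒∉ : not (lookup p x) ≡ true → x ∉ p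
not-lookup⇒∉ {p = p} {x = x} not-true x∈p with lookup p x | []=⇒lookup x∈p
not-lookup⇒∉ () _ | true | refl

∧-true⁻ : ∀ {u v} → u ∧ v ≡ true → u ≡ true × v ≡ true
∧-true⁻ {true} {true} _ = refl , refl

∧-true⁺ : ∀ {u v} → u ≡ true → v ≡ true → u ∧ v ≡ true
∧-true⁺ refl refl = refl

∨-true⁻ : ∀ {u v} → u ∨ v ≡ true → u ≡ true ⊎ v ≡ true
∨-true⁻ {true} _ = inj₁ refl
∨-true⁻ {false} v≡true = inj₂ v≡true

does-true⇒ : ∀ {P : Set} (d : Dec P) → does d ≡ true → P
does-true⇒ (yes p) _ = p

module _ {a b : ℕ} (K : BGraph a b) where

  Closed : Subset b → Set
  Closed C = ∀ {x y y′} → ed K x y ≡ true → ed K x y′ ≡ true → y ∈ C → y′ ∈ C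

  LeavingEdge : Subset b → Set
  LeavingEdge C = ∃ λ x → ∃ λ y → ∃ λ y′ →
    ed K x y ≡ true × ed K x y′ ≡ true × y ∈ C × y′ ∉ C

  leaving? : ∀ C → Dec (LeavingEdge C)
  leaving? C = any? λ x → any? λ y → any? λ y′ →
    (ed K x y Data.Bool.≟ true) ×-dec (ed K x y′ Data.Bool.≟ true) ×-dec (y ∈? C) ×-dec ¬? (y′ ∈? C)

  no-leaving⇒closed : ∀ {C} → ¬ LeavingEdge C → Closed C
  no-leaving⇒closed {C} none {x} {y} {y′} e e′ y∈C =
    decidable-stable (y′ ∈? C) λ y′∉C → none (x , y , y′ , e , e′ , y∈C , y′∉C)

  ReachableFrom : Vtx a b → Subset b → Set
  ReachableFrom u C = ∀ {y} → y ∈ C → Reach K u (inj₂ y)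

  NoIsolatedX : Set
  NoIsolatedX = ∀ {x} → x ∈ vx K → ∃ λ y → ed K x y ≡ true

module _ {a b : ℕ} {K : BGraph a b} where

  reach-end : ∀ {u v} → Reach K u v → InV K v
  reach-end (here v∈K) = v∈K
  reach-end (step _ r) = reach-end r

  reach-snoc : ∀ {u v w} → Reach K u v → Adj K v w → InV K w → Reach K u w
  reach-snoc (here _) vw w∈K = step vw (here w∈K)
  reach-snoc (step uu′ r) vw w∈K = step uu′ (reach-snoc r vw w∈K)

module _ {a b : ℕ} {K : BGraph a b} (wf : WellFormed K) where

  module _ {u : Vtx a b} where

    reachable-extend : ∀ {C x y y′} → ReachableFrom K u C →
      ed K x y ≡ true → ed K x y′ ≡ true → y ∈ C → ReachableFrom K u (C ∪ ⁅ y′ ⁆)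
    reachable-extend {C} {x} {y} {y′} reach e e′ y∈C z∈ with x∈p∪q⁻ C ⁅ y′ ⁆ z∈
    ... | inj₁ z∈C = reach z∈C
    ... | inj₂ z∈⁅y′⁆ rewrite x∈⁅y⁆⇒x≡y y′ z∈⁅y′⁆ =
      reach-snoc (reach-snoc {v = inj₂ y} {w = inj₁ x} (reach y∈C) e (proj₁ (wf x y e))) e′ (proj₂ (wf x y′ e′))

    closure : ∀ k C → b ≤ k + ∣ C ∣ → ReachableFrom K u C →
      ∃ λ D → C ⊆ D × ReachableFrom K u D × Closed K D
    closure k C bound reach with leaving? K C
    ... | no none = C , (λ y∈C → y∈C) , reach , no-leaving⇒closed K none
    ... | yes (x , y , y′ , e , e′ , y∈C , y′∉C) = grow k bound
      where
      ∣C∣<∣C′∣ : ∣ C ∣ < ∣ C ∪ ⁅ y′ ⁆ ∣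
      ∣C∣<∣C′∣ = p⊂q⇒∣p∣<∣q∣ (p⊆p∪q ⁅ y′ ⁆ , y′ , x∈p∪q⁺ (inj₂ (x∈⁅x⁆ y′)) , y′∉C)
      grow : ∀ k → b ≤ k + ∣ C ∣ → ∃ λ D → C ⊆ D × ReachableFrom K u D × Closed K D
      grow zero bound = ⊥-elim (<⇒≱ (<-≤-trans ∣C∣<∣C′∣ (∣p∣≤n (C ∪ ⁅ y′ ⁆))) bound)
      grow (suc k) bound with closure k (C ∪ ⁅ y′ ⁆)
          (≤-trans bound (≤-trans (≤-reflexive (sym (+-suc k ∣ C ∣))) (+-monoʳ-≤ k ∣C∣<∣C′∣)))
          (reachable-extend reach e e′ y∈C)
      ... | D , C′⊆D , reachD , closedD = D , C′⊆D ∘ p⊆p∪q ⁅ y′ ⁆ , reachD , closedD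

  anchor : NoIsolatedX K → ∀ {w} → InV K w →
    ∃ λ y → y ∈ vy K × Reach K w (inj₂ y) × (∀ {u} → Reach K u (inj₂ y) → Reach K u w)
  anchor _ {inj₂ y} y∈K = y , y∈K , here y∈K , λ r → r
  anchor noIsolated {inj₁ x} x∈K with noIsolated x∈K
  ... | y , e = y , proj₂ (wf x y e) , step e (here (proj₂ (wf x y e))) , λ r → reach-snoc r e x∈K

  reach-or-cut : NoIsolatedX K → ∀ {u v} → InV K u → InV K v →
    Reach K u v ⊎ ∃ λ C → Closed K C × C ⊆ vy K × Nonempty C × Nonempty (vy K ─ C)
  reach-or-cut noIsolated {u} u∈K v∈K
    with anchor noIsolated u∈K | anchor noIsolated v∈K
  ... | y₀ , _ , u⇝y₀ , _ | y₁ , y₁∈K , _ , ⇝y₁⇒⇝v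
    with closure {u} b ⁅ y₀ ⁆ (m≤m+n b _) (λ y∈⁅y₀⁆ → subst (λ z → Reach K u (inj₂ z)) (sym (x∈⁅y⁆⇒x≡y y₀ y∈⁅y₀⁆)) u⇝y₀)
  ... | C , y₀∈C , reachC , closedC with y₁ ∈? C
  ... | yes y₁∈C = inj₁ (⇝y₁⇒⇝v (reachC y₁∈C))
  ... | no y₁∉C = inj₂ (C , closedC , (λ y∈C → reach-end (reachC y∈C)) ,
                        (y₀ , y₀∈C (x∈⁅x⁆ y₀)) , (y₁ , x∈p∧x∉q⇒x∈p─q y₁∈K y₁∉C))

path⇒IsP3 : ∀ {a b} {G : BGraph a b} {x₀ p q} → WellFormed G → p ≢ q →
  (∀ {x} → x ∈ vx G → x ≡ x₀) → (∀ {y} → y ∈ vy G → y ≡ p ⊎ y ≡ q) →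
  ed G x₀ p ≡ true → ed G x₀ q ≡ true → IsP3 G
path⇒IsP3 {G = G} {x₀} {p} {q} wf p≢q onlyX onlyY e₀p e₀q =
  inj₂ p , inj₁ x₀ , inj₂ q , (λ ()) , (λ ()) , p≢q ∘ inj₂-injective , vertices , edges
  where
  u v w : Vtx _ _
  u = inj₂ p
  v = inj₁ x₀
  w = inj₂ q
  vertices : ∀ z → (InV G z → z ≡ u ⊎ z ≡ v ⊎ z ≡ w) × (z ≡ u ⊎ z ≡ v ⊎ z ≡ w → InV G z)
  vertices (inj₁ x) = (λ x∈G → inj₂ (inj₁ (cong inj₁ (onlyX x∈G)))) ,
    λ { (inj₁ ()) ; (inj₂ (inj₁ refl)) → proj₁ (wf x₀ p e₀p) ; (inj₂ (inj₂ ())) }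
  vertices (inj₂ y) = (λ y∈G → [ inj₁ ∘ cong inj₂ , inj₂ ∘ inj₂ ∘ cong inj₂ ]′ (onlyY y∈G)) ,
    λ { (inj₁ refl) → proj₂ (wf x₀ p e₀p) ; (inj₂ (inj₁ ())) ; (inj₂ (inj₂ refl)) → proj₂ (wf x₀ q e₀q) }
  ends : ∀ {x y} → ed G x y ≡ true → x ≡ x₀ × (y ≡ p ⊎ y ≡ q)
  ends {x} {y} e = onlyX (proj₁ (wf x y e)) , onlyY (proj₂ (wf x y e))
  edges : ∀ z z′ → (Adj G z z′ → SamePair z z′ u v ⊎ SamePair z z′ v w)
                 × (SamePair z z′ u v ⊎ SamePair z z′ v w → Adj G z z′)
  edges (inj₁ x) (inj₂ y) = forward , backward
    where
    forward : ed G x y ≡ true → SamePair (inj₁ x) (inj₂ y) u v ⊎ SamePair (inj₁ x) (inj₂ y) v w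
    forward e with ends e
    ... | refl , inj₁ refl = inj₁ (inj₂ (refl , refl))
    ... | refl , inj₂ refl = inj₂ (inj₁ (refl , refl))
    backward : SamePair (inj₁ x) (inj₂ y) u v ⊎ SamePair (inj₁ x) (inj₂ y) v w → ed G x y ≡ true
    backward (inj₁ (inj₂ (refl , refl))) = e₀p
    backward (inj₂ (inj₁ (refl , refl))) = e₀q
  edges (inj₂ y) (inj₁ x) = forward , backward
    where
    forward : ed G x y ≡ true → SamePair (inj₂ y) (inj₁ x) u v ⊎ SamePair (inj₂ y) (inj₁ x) v w
    forward e with ends e
    ... | refl , inj₁ refl = inj₁ (inj₁ (refl , refl))
    ... | refl , inj₂ refl = inj₂ (inj₂ (refl , refl))
    backward : SamePair (inj₂ y) (inj₁ x) u v ⊎ SamePair (inj₂ y) (inj₁ x) v w → ed G x y ≡ true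
    backward (inj₁ (inj₁ (refl , refl))) = e₀p
    backward (inj₂ (inj₂ (refl , refl))) = e₀q
  edges (inj₁ _) (inj₁ _) = (λ ()) ,
    λ { (inj₁ (inj₁ (() , _))) ; (inj₁ (inj₂ (_ , ()))) ; (inj₂ (inj₁ (_ , ()))) ; (inj₂ (inj₂ (() , _))) }
  edges (inj₂ _) (inj₂ _) = (λ ()) ,
    λ { (inj₁ (inj₁ (_ , ()))) ; (inj₁ (inj₂ (() , _))) ; (inj₂ (inj₁ (() , _))) ; (inj₂ (inj₂ (_ , ()))) }

TwoSeparation-sym : ∀ {a b} {K G₁ G₂ : BGraph a b} → TwoSeparation K G₁ G₂ → TwoSeparation K G₂ G₁
TwoSeparation-sym {G₁ = G₁} {G₂} (sub₁ , sub₂ , disjoint , vx∪ , vy∪ , ed∪ , shared , big₁ , big₂) =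
  sub₂ , sub₁ , (λ x y (e₂ , e₁) → disjoint x y (e₁ , e₂)) ,
  trans (∪-comm (vx G₂) (vx G₁)) vx∪ , trans (∪-comm (vy G₂) (vy G₁)) vy∪ ,
  (λ x y → trans (ed∪ x y) (∨-comm (ed G₁ x y) (ed G₂ x y))) ,
  trans (cong₂ _+_ (cong ∣_∣ (∩-comm (vx G₂) (vx G₁))) (cong ∣_∣ (∩-comm (vy G₂) (vy G₁)))) shared ,
  big₂ , big₁

edge∉G₂⇒edge∈G₁ : ∀ {a b} {K G₁ G₂ : BGraph a b} → TwoSeparation K G₁ G₂ → ∀ {x y} →
  ed K x y ≡ true → ¬ (x ∈ vx G₂ × y ∈ vy G₂) → ed G₁ x y ≡ true
edge∉G₂⇒edge∈G₁ (_ , (wf₂ , _) , _ , _ , _ , ed∪ , _) {x} {y} e ∉G₂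
  with ∨-true⁻ (trans (sym (ed∪ x y)) e)
... | inj₁ e₁ = e₁
... | inj₂ e₂ = ⊥-elim (∉G₂ (wf₂ x y e₂))

module _ {a b : ℕ} (E : Fin a → Fin b → Bool) where

  N : Subset b → Subset a
  N Z = tabulate λ x → does (any? λ y → (y ∈? Z) ×-dec (E x y Data.Bool.≟ true))

  row : Fin a → Subset b
  row x = tabulate (E x)

  col : Fin b → Subset a
  col y = tabulate λ x → E x y

  module _ {Z : Subset b} {x : Fin a} where

    x∈N⁺ : ∀ {y} → y ∈ Z → E x y ≡ true → x ∈ N Z
    x∈N⁺ {y} y∈Z e = ∈-tabulate⁺ (dec-true (any? _) (y , y∈Z , e))

    x∈N⁻ : x ∈ N Z → ∃ λ y → y ∈ Z × E x y ≡ true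
    x∈N⁻ x∈NZ = does-true⇒ (any? _) (∈-tabulate⁻ x∈NZ)

  N-mono : ∀ {Z W} → Z ⊆ W → N Z ⊆ N W
  N-mono Z⊆W x∈NZ with x∈N⁻ x∈NZ
  ... | y , y∈Z , e = x∈N⁺ (Z⊆W y∈Z) e

  col⊆N : ∀ {Z y} → y ∈ Z → col y ⊆ N Z
  col⊆N y∈Z x∈col = x∈N⁺ y∈Z (∈-tabulate⁻ x∈col)

  neighbour-outside : ∀ {k T S x} → suc k ≤ ∣ row x ∩ T ∣ → ∣ S ∣ ≤ k →
    ∃ λ y → y ∈ T ─ S × E x y ≡ true
  neighbour-outside {T = T} {S} {x} deg ∣S∣≤k with ⊆⊎∃∉ (row x ∩ T) S
  ... | inj₁ ⊆S = ⊥-elim (<⇒≱ (<-≤-trans (s≤s ∣S∣≤k) deg) (p⊆q⇒∣p∣≤∣q∣ ⊆S))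
  ... | inj₂ (y , y∈ , y∉S) with x∈p∩q⁻ (row x) T y∈
  ... | y∈row , y∈T = y , x∈p∧x∉q⇒x∈p─q y∈T y∉S , ∈-tabulate⁻ y∈row

  two-neighbours : ∀ {T x} → 2 ≤ ∣ row x ∩ T ∣ →
    ∃ λ p → ∃ λ q → p ≢ q × p ∈ T × q ∈ T × E x p ≡ true × E x q ≡ true
  two-neighbours {T} deg
    with neighbour-outside {k = 1} {S = ⊥} deg (≤-trans (≤-reflexive (∣⊥∣≡0 b)) z≤n)
  ... | p , p∈T─⊥ , e-p with neighbour-outside {k = 1} {S = ⁅ p ⁆} deg (≤-reflexive (∣⁅x⁆∣≡1 p))
  ... | q , q∈T-p , e-q =
    p , q , (λ { refl → proj₂ (x∈p─q⁻ T ⁅ p ⁆ q∈T-p) (x∈⁅x⁆ p) }) ,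
    p─q⊆p T ⊥ p∈T─⊥ , p─q⊆p T ⁅ p ⁆ q∈T-p , e-p , e-q

  -- Expanding Z is ¬ Tight 4 Z, and 2|X| ≤ |Y| + 4 makes all of Y 4-tight.
  Tight : ℕ → Subset b → Set
  Tight c Z = 2 * ∣ N Z ∣ ≤ c + ∣ Z ∣

  Expanding : Subset b → Set
  Expanding Z = 5 + ∣ Z ∣ ≤ 2 * ∣ N Z ∣

  ProperSubsetsExpand : Subset b → Set
  ProperSubsetsExpand Y = ∀ {Z} → Z ⊂ Y → Nonempty Z → Expanding Z

  separation-bound : ∀ {c} {T A B SY : Subset b} {SX : Subset a} →
    A ⊆ T → B ⊆ T → T ⊆ A ∪ B ∪ SY → N A ∩ N B ⊆ SX →
    Expanding A → Expanding B → Tight c T → 10 ≤ c + 2 * (∣ SX ∣ + ∣ SY ∣)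
  separation-bound {c} {T} {A} {B} {SY} {SX} A⊆T B⊆T cover shared expandA expandB tightT =
    +-cancelˡ-≤ (∣ A ∣ + ∣ B ∣) 10 _ (begin
      ∣ A ∣ + ∣ B ∣ + 10                          ≡⟨ regroup (∣ A ∣) (∣ B ∣) ⟩
      (5 + ∣ A ∣) + (5 + ∣ B ∣)                   ≤⟨ +-mono-≤ expandA expandB ⟩
      2 * ∣ N A ∣ + 2 * ∣ N B ∣                   ≡⟨ *-distribˡ-+ 2 (∣ N A ∣) (∣ N B ∣) ⟨
      2 * (∣ N A ∣ + ∣ N B ∣)                     ≤⟨ *-monoʳ-≤ 2 neighbours ⟩
      2 * (∣ N T ∣ + ∣ SX ∣)                      ≡⟨ *-distribˡ-+ 2 (∣ N T ∣) (∣ SX ∣) ⟩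
      2 * ∣ N T ∣ + 2 * ∣ SX ∣                    ≤⟨ +-monoˡ-≤ _ tightT ⟩
      c + ∣ T ∣ + 2 * ∣ SX ∣                      ≤⟨ +-monoˡ-≤ _ (+-monoʳ-≤ c vertices) ⟩
      c + (∣ A ∣ + (∣ B ∣ + ∣ SY ∣)) + 2 * ∣ SX ∣   ≤⟨ m≤m+n _ ∣ SY ∣ ⟩
      c + (∣ A ∣ + (∣ B ∣ + ∣ SY ∣)) + 2 * ∣ SX ∣ + ∣ SY ∣
                                                 ≡⟨ rearrange c (∣ A ∣) (∣ B ∣) (∣ SX ∣) (∣ SY ∣) ⟩
      ∣ A ∣ + ∣ B ∣ + (c + 2 * (∣ SX ∣ + ∣ SY ∣))   ∎)
    where
    open ≤-Reasoning
    regroup : ∀ α β → α + β + 10 ≡ (5 + α) + (5 + β)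
    regroup = solve-∀
    rearrange : ∀ c α β t s → c + (α + (β + s)) + 2 * t + s ≡ α + β + (c + 2 * (t + s))
    rearrange = solve-∀
    neighbours : ∣ N A ∣ + ∣ N B ∣ ≤ ∣ N T ∣ + ∣ SX ∣
    neighbours = begin
      ∣ N A ∣ + ∣ N B ∣                       ≡⟨ ∣p∪q∣+∣p∩q∣≡∣p∣+∣q∣ (N A) (N B) ⟨
      ∣ N A ∪ N B ∣ + ∣ N A ∩ N B ∣           ≤⟨ +-mono-≤ (p⊆q⇒∣p∣≤∣q∣ ([ N-mono A⊆T , N-mono B⊆T ] ∘ x∈p∪q⁻ (N A) (N B)))
                                                         (p⊆q⇒∣p∣≤∣q∣ shared) ⟩
      ∣ N T ∣ + ∣ SX ∣                        ∎
    vertices : ∣ T ∣ ≤ ∣ A ∣ + (∣ B ∣ + ∣ SY ∣)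
    vertices = begin
      ∣ T ∣                      ≤⟨ p⊆q⇒∣p∣≤∣q∣ cover ⟩
      ∣ A ∪ B ∪ SY ∣             ≤⟨ ∣p∪q∣≤∣p∣+∣q∣ A (B ∪ SY) ⟩
      ∣ A ∣ + ∣ B ∪ SY ∣         ≤⟨ +-monoʳ-≤ ∣ A ∣ (∣p∪q∣≤∣p∣+∣q∣ B SY) ⟩
      ∣ A ∣ + (∣ B ∣ + ∣ SY ∣)   ∎

  minimal-tight : ∀ {Z} → Nonempty Z → Tight 4 Z →
    ∃ λ Y → Nonempty Y × Tight 4 Y × ProperSubsetsExpand Y
  minimal-tight {Z} = descend ∣ Z ∣ ≤-refl
    where
    descend : ∀ k {Z} → ∣ Z ∣ ≤ k → Nonempty Z → Tight 4 Z →
      ∃ λ Y → Nonempty Y × Tight 4 Y × ProperSubsetsExpand Y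
    descend zero ∣Z∣≤0 (_ , z∈Z) _ = ⊥-elim (<⇒≱ (x∈p⇒1≤∣p∣ z∈Z) ∣Z∣≤0)
    descend (suc k) {Z} ∣Z∣≤1+k nonempty tight
      with anySubset? (λ W → (W ⊂? Z) ×-dec nonempty? W ×-dec (2 * ∣ N W ∣ ≤? 4 + ∣ W ∣))
    ... | yes (W , W⊂Z , nonemptyW , tightW) =
      descend k (≤-pred (<-≤-trans (p⊂q⇒∣p∣<∣q∣ W⊂Z) ∣Z∣≤1+k)) nonemptyW tightW
    ... | no noTightSubset =
      Z , nonempty , tight , λ {W} W⊂Z nonemptyW → ≰⇒> λ tightW → noTightSubset (W , W⊂Z , nonemptyW , tightW)

  record IsInduced (K : BGraph a b) : Set where
    constructor mkInduced
    field
      edge⁻ : ∀ {x y} → ed K x y ≡ true → x ∈ vx K × y ∈ vy K × E x y ≡ true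
      edge⁺ : ∀ {x y} → x ∈ vx K → y ∈ vy K → E x y ≡ true → ed K x y ≡ true

    wellFormed : WellFormed K
    wellFormed x y e = proj₁ (edge⁻ e) , proj₁ (proj₂ (edge⁻ e))

    subgraph : SubgraphOf K (whole E)
    subgraph = wellFormed , (λ _ → ∈⊤) , (λ _ → ∈⊤) , λ x y e → proj₂ (proj₂ (edge⁻ e))

  open IsInduced

  induced : Subset b → BGraph a b
  induced Y = mkBG (N Y) Y λ x y → E x y ∧ lookup Y y

  induced-isInduced : ∀ Y → IsInduced (induced Y)
  induced-isInduced Y = mkInduced edge⁻′ edge⁺′
    where
    edge⁻′ : ∀ {x y} → E x y ∧ lookup Y y ≡ true → x ∈ N Y × y ∈ Y × E x y ≡ true
    edge⁻′ {x} {y} e with ∧-true⁻ {E x y} e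
    ... | e′ , y∈Y = x∈N⁺ (lookup⇒[]= y Y y∈Y) e′ , lookup⇒[]= y Y y∈Y , e′
    edge⁺′ : ∀ {x y} → x ∈ N Y → y ∈ Y → E x y ≡ true → E x y ∧ lookup Y y ≡ true
    edge⁺′ _ y∈Y e = ∧-true⁺ e ([]=⇒lookup y∈Y)

  delete-isInduced : ∀ {K} → IsInduced K → ∀ SX SY → IsInduced (delete K SX SY)
  delete-isInduced {K} isInduced SX SY = mkInduced edge⁻′ edge⁺′
    where
    edge⁻′ : ∀ {x y} → ed (delete K SX SY) x y ≡ true → x ∈ vx K ─ SX × y ∈ vy K ─ SY × E x y ≡ true
    edge⁻′ {x} {y} e with ∧-true⁻ {ed K x y} e
    ... | eK , kept with ∧-true⁻ {not (lookup SX x)} kept | edge⁻ isInduced eK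
    ... | x-kept , y-kept | x∈K , y∈K , e′ =
      x∈p∧x∉q⇒x∈p─q x∈K (not-lookup⇒∉ x-kept) , x∈p∧x∉q⇒x∈p─q y∈K (not-lookup⇒∉ y-kept) , e′
    edge⁺′ : ∀ {x y} → x ∈ vx K ─ SX → y ∈ vy K ─ SY → E x y ≡ true → ed (delete K SX SY) x y ≡ true
    edge⁺′ x∈ y∈ e with x∈p─q⁻ (vx K) SX x∈ | x∈p─q⁻ (vy K) SY y∈
    ... | x∈K , x∉SX | y∈K , y∉SY =
      ∧-true⁺ (edge⁺ isInduced x∈K y∈K e) (∧-true⁺ (∉⇒not-lookup x∉SX) (∉⇒not-lookup y∉SY))

  closed-split⇒large-deletion : ∀ {K SX SY c C} → IsInduced K → N (vy K) ⊆ vx K →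
    ProperSubsetsExpand (vy K) → Tight c (vy K) →
    Closed (delete K SX SY) C → C ⊆ vy K ─ SY → Nonempty C → Nonempty ((vy K ─ SY) ─ C) →
    10 ≤ c + 2 * (∣ SX ∣ + ∣ SY ∣)
  closed-split⇒large-deletion {K} {SX} {SY} {c} {C} isInduced N⊆vx expand tight closed C⊆ (y₀ , y₀∈C) (y₁ , y₁∈B) =
    separation-bound C⊆T B⊆T cover shared
      (expand (C⊆T , y₁ , B⊆T y₁∈B , proj₂ (x∈p─q⁻ _ C y₁∈B)) (y₀ , y₀∈C))
      (expand (B⊆T , y₀ , C⊆T y₀∈C , λ y₀∈B → proj₂ (x∈p─q⁻ _ C y₀∈B) y₀∈C) (y₁ , y₁∈B))
      tight
    where
    D = delete K SX SY
    inducedD = delete-isInduced isInduced SX SY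
    B = vy D ─ C
    C⊆T : C ⊆ vy K
    C⊆T = p─q⊆p (vy K) SY ∘ C⊆
    B⊆T : B ⊆ vy K
    B⊆T = p─q⊆p (vy K) SY ∘ p─q⊆p (vy D) C
    cover : vy K ⊆ C ∪ B ∪ SY
    cover {y} y∈K with y ∈? SY | y ∈? C
    ... | yes y∈SY | _ = x∈p∪q⁺ (inj₂ (x∈p∪q⁺ (inj₂ y∈SY)))
    ... | no _ | yes y∈C = x∈p∪q⁺ (inj₁ y∈C)
    ... | no y∉SY | no y∉C = x∈p∪q⁺ (inj₂ (x∈p∪q⁺ (inj₁ (x∈p∧x∉q⇒x∈p─q (x∈p∧x∉q⇒x∈p─q y∈K y∉SY) y∉C))))
    shared : N C ∩ N B ⊆ SX
    shared {x} x∈ with x ∈? SX | x∈p∩q⁻ (N C) (N B) x∈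
    ... | yes x∈SX | _ = x∈SX
    ... | no x∉SX | x∈NC , x∈NB with x∈N⁻ x∈NC | x∈N⁻ x∈NB
    ... | yc , yc∈C , ec | yb , yb∈B , eb = ⊥-elim (proj₂ (x∈p─q⁻ _ C yb∈B) (closed edge-c edge-b yc∈C))
      where
      x∈D : x ∈ vx D
      x∈D = x∈p∧x∉q⇒x∈p─q (N⊆vx (N-mono C⊆T x∈NC)) x∉SX
      edge-c = edge⁺ inducedD x∈D (C⊆ yc∈C) ec
      edge-b = edge⁺ inducedD x∈D (p─q⊆p (vy D) C yb∈B) eb

  delete-connected : ∀ {K SX SY c k} → IsInduced K → N (vy K) ⊆ vx K →
    ProperSubsetsExpand (vy K) → Tight c (vy K) →
    ∣ SX ∣ + ∣ SY ∣ ≤ k → c + 2 * k < 10 →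
    (∀ {x} → x ∈ vx K ─ SX → ∃ λ y → y ∈ vy K ─ SY × E x y ≡ true) →
    Connected (delete K SX SY)
  delete-connected {K} {SX} {SY} {c} isInduced N⊆vx expand tight ∣S∣≤k small survive u v u∈ v∈ =
    [ (λ u⇝v → u⇝v) , (λ (C , closed , C⊆ , nonemptyC , nonemptyB) → ⊥-elim (<⇒≱ deletion-small
        (closed-split⇒large-deletion {SX = SX} isInduced N⊆vx expand tight closed C⊆ nonemptyC nonemptyB))) ]′
      (reach-or-cut (wellFormed inducedD) noIsolated u∈ v∈)
    where
    inducedD = delete-isInduced isInduced SX SY
    noIsolated : NoIsolatedX (delete K SX SY)
    noIsolated x∈ with survive x∈
    ... | y , y∈ , e = y , edge⁺ inducedD x∈ y∈ e
    deletion-small : c + 2 * (∣ SX ∣ + ∣ SY ∣) < 10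
    deletion-small = ≤-<-trans (+-monoʳ-≤ c (*-monoʳ-≤ 2 ∣S∣≤k)) small

  module _ {K : BGraph a b} (isInduced : IsInduced K) (N⊆vx : N (vy K) ⊆ vx K)
    (nonempty : Nonempty (vy K)) (expand : ∀ {Z} → Z ⊆ vy K → Nonempty Z → Expanding Z)
    (tight : Tight 5 (vy K)) (degree : ∀ {x} → x ∈ vx K → 2 ≤ ∣ row x ∩ vy K ∣) where

    private
      T = vy K

    neighbours-in-pair⇒unique : ∀ {p q x z} → p ∈ T → q ∈ T → p ≢ q → x ∈ N T → z ∈ N T →
      (∀ {y} → y ∈ T → E x y ≡ true → y ≡ p ⊎ y ≡ q) →
      (∀ {y} → y ∈ T → E z y ≡ true → y ≡ p ⊎ y ≡ q) → x ≡ z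
    neighbours-in-pair⇒unique {p} {q} {x} {z} p∈T q∈T p≢q x∈NT z∈NT x-in-pair z-in-pair =
      decidable-stable (x ≟ z) distinct⇒⊥
      where
      P = ⁅ p ⁆ ∪ ⁅ q ⁆
      B = T ─ P
      B⊆T : B ⊆ T
      B⊆T = p─q⊆p T P
      T-bound : ∣ T ∣ ≤ 2 + ∣ B ∣
      T-bound = begin
        ∣ T ∣                           ≤⟨ p⊆q⇒∣p∣≤∣q∣ T⊆P∪B ⟩
        ∣ P ∪ B ∣                       ≤⟨ ∣p∪q∣≤∣p∣+∣q∣ P B ⟩
        ∣ P ∣ + ∣ B ∣                   ≤⟨ +-monoˡ-≤ ∣ B ∣ (∣⁅y⁆∪⁅z⁆∣≤2 p q) ⟩
        2 + ∣ B ∣                       ∎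
        where
        open ≤-Reasoning
        T⊆P∪B : T ⊆ P ∪ B
        T⊆P∪B {y} y∈T with y ∈? P
        ... | yes y∈P = x∈p∪q⁺ (inj₁ y∈P)
        ... | no y∉P = x∈p∪q⁺ (inj₂ (x∈p∧x∉q⇒x∈p─q y∈T y∉P))
      in-pair⇒∉NB : ∀ {w} → (∀ {y} → y ∈ T → E w y ≡ true → y ≡ p ⊎ y ≡ q) → w ∉ N B
      in-pair⇒∉NB w-in-pair w∈NB with x∈N⁻ w∈NB
      ... | y , y∈B , e with x∈p─q⁻ T P y∈B
      ... | y∈T , y∉P = y∉P (x∈⁅y⁆∪⁅z⁆⁺ (w-in-pair y∈T e))
      distinct⇒⊥ : x ≢ z → False
      distinct⇒⊥ x≢z with nonempty? B
      ... | yes nonemptyB = 1+n≰n (begin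
        suc (7 + ∣ B ∣)          ≤⟨ n≤1+n _ ⟩
        4 + (5 + ∣ B ∣)          ≤⟨ +-monoʳ-≤ 4 (expand B⊆T nonemptyB) ⟩
        4 + 2 * ∣ N B ∣          ≡⟨ *-distribˡ-+ 2 2 (∣ N B ∣) ⟨
        2 * (2 + ∣ N B ∣)        ≤⟨ *-monoʳ-≤ 2 NB-misses-x-z ⟩
        2 * ∣ N T ∣              ≤⟨ tight ⟩
        5 + ∣ T ∣                ≤⟨ +-monoʳ-≤ 5 T-bound ⟩
        7 + ∣ B ∣                ∎)
        where
        open ≤-Reasoning
        NB-misses-x-z : 2 + ∣ N B ∣ ≤ ∣ N T ∣
        NB-misses-x-z = begin
          2 + ∣ N B ∣              ≤⟨ +-monoʳ-≤ 2 (p⊆q⇒∣p∣≤∣q∣ NB⊆NT-x-z) ⟩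
          2 + ∣ N T - x - z ∣      ≡⟨ cong suc (x∈p⇒∣p∣≡suc∣p-x∣ (N T - x) (x∈p∧x≢y⇒x∈p-y z∈NT (x≢z ∘ sym))) ⟨
          suc ∣ N T - x ∣          ≡⟨ x∈p⇒∣p∣≡suc∣p-x∣ (N T) x∈NT ⟨
          ∣ N T ∣                  ∎
          where
          NB⊆NT-x-z : N B ⊆ N T - x - z
          NB⊆NT-x-z w∈NB = x∈p∧x≢y⇒x∈p-y
            (x∈p∧x≢y⇒x∈p-y (N-mono B⊆T w∈NB) λ { refl → in-pair⇒∉NB x-in-pair w∈NB })
            λ { refl → in-pair⇒∉NB z-in-pair w∈NB }
      -- Here T = {p, q}, and tightness together with expansion of T itself force 2|N(T)| = 7.
      ... | no emptyB = 2*n≢7 ∣ N T ∣ (trans (≤-antisym tight (expand ⊆-refl (p , p∈T))) (cong (5 +_) ∣T∣≡2))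
        where
        ∣T∣≡2 : ∣ T ∣ ≡ 2
        ∣T∣≡2 = ≤-antisym
          (≤-trans T-bound (≤-reflexive (cong (2 +_) (trans (cong ∣_∣ (Empty-unique emptyB)) (∣⊥∣≡0 b)))))
          (two-elements⇒2≤∣p∣ p∈T q∈T p≢q)

    vx⊆NT : vx K ⊆ N T
    vx⊆NT x∈K with two-neighbours (degree x∈K)
    ... | p , _ , _ , p∈T , _ , e-p , _ = x∈N⁺ p∈T e-p

    edge∈G₁ : ∀ {G₁ G₂ x y} → TwoSeparation K G₁ G₂ → x ∈ vx K → y ∈ T → E x y ≡ true →
      ¬ (x ∈ vx G₂ × y ∈ vy G₂) → ed G₁ x y ≡ true
    edge∈G₁ ts x∈K y∈T e = edge∉G₂⇒edge∈G₁ ts (IsInduced.edge⁺ isInduced x∈K y∈T e)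

    private-neighbour⇒vertex : ∀ {G₁ G₂ x} → TwoSeparation K G₁ G₂ → x ∈ N (vy G₁ ─ vy G₂) → x ∈ vx G₁
    private-neighbour⇒vertex {G₁} {G₂} {x} ts@((wf₁ , _ , vy₁⊆ , _) , _) x∈N with x∈N⁻ x∈N
    ... | y , y∈ , e with x∈p─q⁻ (vy G₁) (vy G₂) y∈
    ... | y∈₁ , y∉₂ = proj₁ (wf₁ x y (edge∈G₁ ts (N⊆vx (x∈N⁺ (vy₁⊆ y∈₁) e)) (vy₁⊆ y∈₁) e (y∉₂ ∘ proj₂)))

    both-sides-private⇒⊥ : ∀ {G₁ G₂} → TwoSeparation K G₁ G₂ →
      (∃ λ y → y ∈ vy G₁ × y ∉ vy G₂) → (∃ λ y → y ∈ vy G₂ × y ∉ vy G₁) → False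
    both-sides-private⇒⊥ {G₁} {G₂} ts@((_ , _ , vy₁⊆ , _) , (_ , _ , vy₂⊆ , _) , _ , _ , vy∪ , _ , shared , _)
      (y₁ , y₁∈₁ , y₁∉₂) (y₂ , y₂∈₂ , y₂∉₁) =
      1+n≰n (subst (λ s → 10 ≤ 5 + 2 * s) shared (separation-bound A⊆T B⊆T cover common
        (expand A⊆T (y₁ , x∈p∧x∉q⇒x∈p─q y₁∈₁ y₁∉₂)) (expand B⊆T (y₂ , x∈p∧x∉q⇒x∈p─q y₂∈₂ y₂∉₁)) tight))
      where
      A = vy G₁ ─ vy G₂
      B = vy G₂ ─ vy G₁
      A⊆T : A ⊆ T
      A⊆T = vy₁⊆ ∘ p─q⊆p (vy G₁) (vy G₂)
      B⊆T : B ⊆ T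
      B⊆T = vy₂⊆ ∘ p─q⊆p (vy G₂) (vy G₁)
      cover : T ⊆ A ∪ B ∪ (vy G₁ ∩ vy G₂)
      cover {y} y∈T with y ∈? vy G₁ | y ∈? vy G₂
      ... | yes y∈₁ | yes y∈₂ = x∈p∪q⁺ (inj₂ (x∈p∪q⁺ (inj₂ (x∈p∩q⁺ (y∈₁ , y∈₂)))))
      ... | yes y∈₁ | no y∉₂ = x∈p∪q⁺ (inj₁ (x∈p∧x∉q⇒x∈p─q y∈₁ y∉₂))
      ... | no y∉₁ | yes y∈₂ = x∈p∪q⁺ (inj₂ (x∈p∪q⁺ (inj₁ (x∈p∧x∉q⇒x∈p─q y∈₂ y∉₁))))
      ... | no y∉₁ | no y∉₂ = ⊥-elim ([ y∉₁ , y∉₂ ]′ (x∈p∪q⁻ (vy G₁) (vy G₂) (subst (y ∈_) (sym vy∪) y∈T)))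
      common : N A ∩ N B ⊆ vx G₁ ∩ vx G₂
      common x∈ with x∈p∩q⁻ (N A) (N B) x∈
      ... | x∈NA , x∈NB = x∈p∩q⁺ (private-neighbour⇒vertex ts x∈NA ,
                                  private-neighbour⇒vertex (TwoSeparation-sym ts) x∈NB)

    private-vertex : ∀ {G₁ G₂} → TwoSeparation K G₁ G₂ → vy G₁ ⊆ vy G₂ → ∃ λ x → x ∈ vx G₁ × x ∉ vx G₂
    private-vertex {G₁} {G₂} (_ , _ , _ , _ , _ , _ , shared , big₁ , _) vy₁⊆vy₂ with ⊆⊎∃∉ (vx G₁) (vx G₂)
    ... | inj₂ x₀ = x₀
    ... | inj₁ vx₁⊆vx₂ = ⊥-elim (<⇒≱ (s≤s (≤-trans
      (+-mono-≤ (p⊆q⇒∣p∣≤∣q∣ (λ x∈₁ → x∈p∩q⁺ (x∈₁ , vx₁⊆vx₂ x∈₁))) (p⊆q⇒∣p∣≤∣q∣ (λ y∈₁ → x∈p∩q⁺ (y∈₁ , vy₁⊆vy₂ y∈₁))))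
      (≤-reflexive shared))) big₁)

    within⇒P3 : ∀ {G₁ G₂} → TwoSeparation K G₁ G₂ → vy G₁ ⊆ vy G₂ → IsP3 G₁
    within⇒P3 {G₁} {G₂} ts@((wf₁ , vx₁⊆ , _ , _) , _ , _ , _ , _ , _ , shared , _) vy₁⊆vy₂
      with private-vertex ts vy₁⊆vy₂
    ... | x₀ , x₀∈₁ , x₀∉₂ with two-neighbours (degree (vx₁⊆ x₀∈₁))
    ... | p , q , p≢q , p∈T , q∈T , e-p , e-q =
      path⇒IsP3 wf₁ p≢q only-x₀ only-p-q
        (proj₁ (private-edge x₀∈₁ x₀∉₂ p∈T e-p)) (proj₁ (private-edge x₀∈₁ x₀∉₂ q∈T e-q))
      -- Two neighbours p, q of the private vertex x₀ are shared by G₁ and G₂, so they form the whole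
      -- separator; hence every X-vertex of G₁ is private and sees only p and q in T.
      where
      SY = vy G₁ ∩ vy G₂
      private-edge : ∀ {x y} → x ∈ vx G₁ → x ∉ vx G₂ → y ∈ T → E x y ≡ true → ed G₁ x y ≡ true × y ∈ SY
      private-edge {x} {y} x∈₁ x∉₂ y∈T e = e₁ , x∈p∩q⁺ (y∈₁ , vy₁⊆vy₂ y∈₁)
        where
        e₁ = edge∈G₁ ts (vx₁⊆ x∈₁) y∈T e (x∉₂ ∘ proj₁)
        y∈₁ = proj₂ (wf₁ x y e₁)
      p∈SY = proj₂ (private-edge x₀∈₁ x₀∉₂ p∈T e-p)
      q∈SY = proj₂ (private-edge x₀∈₁ x₀∉₂ q∈T e-q)
      ∣SY∣≤2 : ∣ SY ∣ ≤ 2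
      ∣SY∣≤2 = ≤-trans (m≤n+m _ _) (≤-reflexive shared)
      in-SY⇒p-q : ∀ {y} → y ∈ SY → y ≡ p ⊎ y ≡ q
      in-SY⇒p-q = two-elements-exhaust ∣SY∣≤2 p∈SY q∈SY p≢q
      all-private : ∀ {x} → x ∈ vx G₁ → x ∉ vx G₂
      all-private x∈₁ x∈₂ = 1+n≰n (≤-trans
        (+-mono-≤ (x∈p⇒1≤∣p∣ (x∈p∩q⁺ (x∈₁ , x∈₂))) (two-elements⇒2≤∣p∣ p∈SY q∈SY p≢q)) (≤-reflexive shared))
      neighbours-in-p-q : ∀ {x} → x ∈ vx G₁ → ∀ {y} → y ∈ T → E x y ≡ true → y ≡ p ⊎ y ≡ q
      neighbours-in-p-q x∈₁ y∈T e = in-SY⇒p-q (proj₂ (private-edge x∈₁ (all-private x∈₁) y∈T e))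
      only-x₀ : ∀ {x} → x ∈ vx G₁ → x ≡ x₀
      only-x₀ x∈₁ = neighbours-in-pair⇒unique p∈T q∈T p≢q (vx⊆NT (vx₁⊆ x∈₁)) (vx⊆NT (vx₁⊆ x₀∈₁))
        (neighbours-in-p-q x∈₁) (neighbours-in-p-q x₀∈₁)
      only-p-q : ∀ {y} → y ∈ vy G₁ → y ≡ p ⊎ y ≡ q
      only-p-q y∈₁ = in-SY⇒p-q (x∈p∩q⁺ (y∈₁ , vy₁⊆vy₂ y∈₁))

    internally-3-connected : InternallyThreeConnected K
    internally-3-connected = (<⇒≤ 4≤nV , connected) , 4≤nV , separation
      where
      1≤∣T∣ : 1 ≤ ∣ T ∣
      1≤∣T∣ = x∈p⇒1≤∣p∣ (proj₂ nonempty)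
      4≤nV : 4 ≤ nV K
      4≤nV = +-mono-≤ {3} {∣ vx K ∣} {1}
        (≤-trans (*-cancelˡ-≤ 2 (≤-trans (+-monoʳ-≤ 5 1≤∣T∣) (expand ⊆-refl nonempty))) (p⊆q⇒∣p∣≤∣q∣ N⊆vx))
        1≤∣T∣
      connected : ∀ SX SY → SX ⊆ vx K → SY ⊆ T → ∣ SX ∣ + ∣ SY ∣ < 2 → Connected (delete K SX SY)
      connected SX SY _ _ ∣S∣<2 =
        delete-connected isInduced N⊆vx (λ Z⊂T → expand (proj₁ Z⊂T)) tight (≤-pred ∣S∣<2) (from-yes (7 <? 10))
          λ x∈ → neighbour-outside (degree (p─q⊆p (vx K) SX x∈)) (≤-trans (m≤n+m ∣ SY ∣ ∣ SX ∣) (≤-pred ∣S∣<2))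
      separation : ∀ G₁ G₂ → TwoSeparation K G₁ G₂ → IsP3 G₁ ⊎ IsP3 G₂
      separation G₁ G₂ ts with ⊆⊎∃∉ (vy G₁) (vy G₂) | ⊆⊎∃∉ (vy G₂) (vy G₁)
      ... | inj₁ vy₁⊆vy₂ | _ = inj₁ (within⇒P3 ts vy₁⊆vy₂)
      ... | inj₂ _ | inj₁ vy₂⊆vy₁ = inj₂ (within⇒P3 (TwoSeparation-sym ts) vy₂⊆vy₁)
      ... | inj₂ private₁ | inj₂ private₂ = ⊥-elim (both-sides-private⇒⊥ ts private₁ private₂)

  Twins : Fin b → Fin b → Set
  Twins y₁ y₂ = y₁ ≢ y₂ × col y₁ ≡ col y₂

  twins? : Dec (∃ λ y₁ → ∃ λ y₂ → Twins y₁ y₂)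
  twins? = any? λ y₁ → any? λ y₂ → ¬? (y₁ ≟ y₂) ×-dec ≡-dec Data.Bool._≟_ (col y₁) (col y₂)

  twins⇒K32 : SemiCubic E → ∀ {y₁ y₂} → Twins y₁ y₂ → ∃[ H ] (SubgraphOf H (whole E) × IsK32 H)
  twins⇒K32 semi {y₁} {y₂} (y₁≢y₂ , same-col) with ∣p∣≡3⇒enumerate (col y₁) (semi y₁)
  ... | x₁ , x₂ , x₃ , x₁≢x₂ , x₂≢x₃ , x₁≢x₃ , x₁∈ , x₂∈ , x₃∈ , exhaust =
    induced P , subgraph (induced-isInduced P) ,
    x₁ , x₂ , x₃ , y₁ , y₂ , x₁≢x₂ , x₂≢x₃ , x₁≢x₃ , y₁≢y₂ , vertices-x ,
    (λ _ → x∈⁅y⁆∪⁅z⁆⁻ , x∈⁅y⁆∪⁅z⁆⁺) , complete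
    where
    P = ⁅ y₁ ⁆ ∪ ⁅ y₂ ⁆
    col-edge : ∀ {x y} → y ∈ P → x ∈ col y₁ → E x y ≡ true
    col-edge y∈P x∈col with x∈⁅y⁆∪⁅z⁆⁻ y∈P
    ... | inj₁ refl = ∈-tabulate⁻ x∈col
    ... | inj₂ refl = ∈-tabulate⁻ (subst (_ ∈_) same-col x∈col)
    NP⊆col : N P ⊆ col y₁
    NP⊆col x∈NP with x∈N⁻ x∈NP
    ... | y , y∈P , e with x∈⁅y⁆∪⁅z⁆⁻ y∈P
    ... | inj₁ refl = ∈-tabulate⁺ e
    ... | inj₂ refl = subst (_ ∈_) (sym same-col) (∈-tabulate⁺ e)
    vertices-x : ∀ x → (x ∈ N P → x ≡ x₁ ⊎ x ≡ x₂ ⊎ x ≡ x₃) × (x ≡ x₁ ⊎ x ≡ x₂ ⊎ x ≡ x₃ → x ∈ N P)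
    vertices-x x = exhaust ∘ NP⊆col , col⊆N (x∈⁅y⁆∪⁅z⁆⁺ (inj₁ refl)) ∘ listed
      where
      listed : x ≡ x₁ ⊎ x ≡ x₂ ⊎ x ≡ x₃ → x ∈ col y₁
      listed (inj₁ refl) = x₁∈
      listed (inj₂ (inj₁ refl)) = x₂∈
      listed (inj₂ (inj₂ refl)) = x₃∈
    complete : ∀ x y → x ∈ N P → y ∈ P → ed (induced P) x y ≡ true
    complete x y x∈NP y∈P = edge⁺ (induced-isInduced P) x∈NP y∈P (col-edge y∈P (NP⊆col x∈NP))

  module _ (semi : SemiCubic E) (noTwins : ¬ ∃ λ y₁ → ∃ λ y₂ → Twins y₁ y₂)
    {Y : Subset b} (tight : Tight 4 Y) (expand : ProperSubsetsExpand Y) {h} (h∈Y : h ∈ Y) where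

    3≤∣NY∣ : 3 ≤ ∣ N Y ∣
    3≤∣NY∣ = ≤-trans (≤-reflexive (sym (semi h))) (p⊆q⇒∣p∣≤∣q∣ (col⊆N h∈Y))

    ∣Y∣≡suc∣Y-h∣ : ∣ Y ∣ ≡ suc ∣ Y - h ∣
    ∣Y∣≡suc∣Y-h∣ = x∈p⇒∣p∣≡suc∣p-x∣ Y h∈Y

    Y-h-nonempty : Nonempty (Y - h)
    Y-h-nonempty = 1≤∣p∣⇒Nonempty (≤-pred (begin
      2          ≤⟨ +-cancelˡ-≤ 4 2 ∣ Y ∣ (≤-trans (*-monoʳ-≤ 2 3≤∣NY∣) tight) ⟩
      ∣ Y ∣      ≡⟨ ∣Y∣≡suc∣Y-h∣ ⟩
      suc ∣ Y - h ∣ ∎))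
      where open ≤-Reasoning

    small⇒twins : ∣ Y ∣ ≤ 2 → ∃ λ y₁ → ∃ λ y₂ → Twins y₁ y₂
    small⇒twins ∣Y∣≤2 with Y-h-nonempty
    ... | y , y∈Y-h with x∈p-y⁻ Y y∈Y-h
    ... | y∈Y , y≢h = h , y , y≢h ∘ sym , trans (col≡NY h∈Y) (sym (col≡NY y∈Y))
      where
      ∣NY∣≤3 : ∣ N Y ∣ ≤ 3
      ∣NY∣≤3 = *-cancelˡ-≤ 2 (≤-trans tight (+-monoʳ-≤ 4 ∣Y∣≤2))
      col≡NY : ∀ {y} → y ∈ Y → col y ≡ N Y
      col≡NY {y} y∈Y = ⊆∧∣⊇∣⇒≡ (col⊆N y∈Y) (≤-trans ∣NY∣≤3 (≤-reflexive (sym (semi y))))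

    degree-three : ∀ {x} → x ∈ N Y → 3 ≤ ∣ row x ∩ Y ∣
    degree-three {x} x∈NY = decidable-stable (3 ≤? ∣ D ∣) λ ∣D∣≱3 → low-degree⇒⊥ (≤-pred (≰⇒> ∣D∣≱3))
      where
      D = row x ∩ Y
      Z = Y ─ D
      Y⊆D∪Z : Y ⊆ D ∪ Z
      Y⊆D∪Z {y} y∈Y with y ∈? D
      ... | yes y∈D = x∈p∪q⁺ (inj₁ y∈D)
      ... | no y∉D = x∈p∪q⁺ (inj₂ (x∈p∧x∉q⇒x∈p─q y∈Y y∉D))
      low-degree⇒⊥ : ∣ D ∣ ≤ 2 → False
      low-degree⇒⊥ ∣D∣≤2 with nonempty? Z | x∈N⁻ x∈NY
      ... | no emptyZ | _ = noTwins (small⇒twins (≤-trans (p⊆q⇒∣p∣≤∣q∣ Y⊆D) ∣D∣≤2))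
        where
        Y⊆D : Y ⊆ D
        Y⊆D y∈Y with x∈p∪q⁻ D Z (Y⊆D∪Z y∈Y)
        ... | inj₁ y∈D = y∈D
        ... | inj₂ y∈Z = ⊥-elim (emptyZ (_ , y∈Z))
      ... | yes nonemptyZ | y₀ , y₀∈Y , e₀ = 1+n≰n (begin
        suc (6 + ∣ Z ∣)          ≡⟨⟩
        2 + (5 + ∣ Z ∣)          ≤⟨ +-monoʳ-≤ 2 (expand Z⊂Y nonemptyZ) ⟩
        2 + 2 * ∣ N Z ∣          ≡⟨ *-distribˡ-+ 2 1 (∣ N Z ∣) ⟨
        2 * suc ∣ N Z ∣          ≤⟨ *-monoʳ-≤ 2 NZ-misses-x ⟩
        2 * ∣ N Y ∣              ≤⟨ tight ⟩
        4 + ∣ Y ∣                ≤⟨ +-monoʳ-≤ 4 (≤-trans (p⊆q⇒∣p∣≤∣q∣ Y⊆D∪Z) (∣p∪q∣≤∣p∣+∣q∣ D Z)) ⟩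
        4 + (∣ D ∣ + ∣ Z ∣)      ≤⟨ +-monoʳ-≤ 4 (+-monoˡ-≤ ∣ Z ∣ ∣D∣≤2) ⟩
        6 + ∣ Z ∣                ∎)
        where
        open ≤-Reasoning
        y₀∈D : y₀ ∈ D
        y₀∈D = x∈p∩q⁺ (∈-tabulate⁺ e₀ , y₀∈Y)
        Z⊂Y : Z ⊂ Y
        Z⊂Y = p─q⊆p Y D , y₀ , y₀∈Y , λ y₀∈Z → proj₂ (x∈p─q⁻ Y D y₀∈Z) y₀∈D
        x∉NZ : x ∉ N Z
        x∉NZ x∈NZ with x∈N⁻ x∈NZ
        ... | y , y∈Z , e with x∈p─q⁻ Y D y∈Z
        ... | y∈Y , y∉D = y∉D (x∈p∩q⁺ (∈-tabulate⁺ e , y∈Y))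
        NZ-misses-x : suc ∣ N Z ∣ ≤ ∣ N Y ∣
        NZ-misses-x = begin
          suc ∣ N Z ∣        ≤⟨ s≤s (p⊆q⇒∣p∣≤∣q∣ NZ⊆NY-x) ⟩
          suc ∣ N Y - x ∣    ≡⟨ x∈p⇒∣p∣≡suc∣p-x∣ (N Y) x∈NY ⟨
          ∣ N Y ∣            ∎
          where
          NZ⊆NY-x : N Z ⊆ N Y - x
          NZ⊆NY-x w∈NZ = x∈p∧x≢y⇒x∈p-y (N-mono (p─q⊆p Y D) w∈NZ) λ { refl → x∉NZ w∈NZ }

    three-connected : KConnected 3 (induced Y)
    three-connected = +-mono-≤ 3≤∣NY∣ (x∈p⇒1≤∣p∣ h∈Y) , λ SX SY _ _ ∣S∣<3 →
      delete-connected (induced-isInduced Y) ⊆-refl expand tight (≤-pred ∣S∣<3) (from-yes (8 <? 10))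
        λ x∈ → neighbour-outside (degree-three (p─q⊆p (N Y) SX x∈)) (≤-trans (m≤n+m ∣ SY ∣ ∣ SX ∣) (≤-pred ∣S∣<3))

    deleted-internally-3-connected : InternallyThreeConnected (deleteY (induced Y) h)
    deleted-internally-3-connected = internally-3-connected
      (delete-isInduced (induced-isInduced Y) ⊥ ⁅ h ⁆) N⊆vx Y-h-nonempty Y-h-expands Y-h-tight degree-two
      where
      open ≤-Reasoning
      N⊆vx : N (Y - h) ⊆ N Y ─ ⊥
      N⊆vx x∈ = x∈p∧x∉q⇒x∈p─q (N-mono (p─q⊆p Y ⁅ h ⁆) x∈) ∉⊥
      Y-h-expands : ∀ {Z} → Z ⊆ Y - h → Nonempty Z → Expanding Z
      Y-h-expands Z⊆Y-h = expand (p─q⊆p Y ⁅ h ⁆ ∘ Z⊆Y-h , h , h∈Y , λ h∈Z → proj₂ (x∈p-y⁻ Y (Z⊆Y-h h∈Z)) refl)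
      Y-h-tight : Tight 5 (Y - h)
      Y-h-tight = begin
        2 * ∣ N (Y - h) ∣     ≤⟨ *-monoʳ-≤ 2 (p⊆q⇒∣p∣≤∣q∣ (N-mono (p─q⊆p Y ⁅ h ⁆))) ⟩
        2 * ∣ N Y ∣           ≤⟨ tight ⟩
        4 + ∣ Y ∣             ≡⟨ cong (4 +_) ∣Y∣≡suc∣Y-h∣ ⟩
        4 + suc ∣ Y - h ∣     ≡⟨ +-suc 4 ∣ Y - h ∣ ⟩
        5 + ∣ Y - h ∣         ∎
      degree-two : ∀ {x} → x ∈ N Y ─ ⊥ → 2 ≤ ∣ row x ∩ (Y - h) ∣
      degree-two {x} x∈ = ≤-pred (≤-trans (degree-three (p─q⊆p (N Y) ⊥ x∈)) (∣p∩q∣≤suc∣p∩q-y∣ (row x) Y h))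

  no-twins⇒3-connected : SemiCubic E → ¬ (∃ λ y₁ → ∃ λ y₂ → Twins y₁ y₂) →
    ∀ {Z} → Nonempty Z → Tight 4 Z →
    ∃[ H ] (SubgraphOf H (whole E) × KConnected 3 H × ∃[ h ] (h ∈ vy H × InternallyThreeConnected (deleteY H h)))
  no-twins⇒3-connected semi noTwins nonempty tight with minimal-tight nonempty tight
  ... | Y , (h , h∈Y) , tightY , expandY =
    induced Y , subgraph (induced-isInduced Y) , three-connected semi noTwins tightY expandY h∈Y ,
    h , h∈Y , deleted-internally-3-connected semi noTwins tightY expandY h∈Y

lemma3p2 : (a b : ℕ) (E : Fin a → Fin b → Bool) → SemiCubic E
    → 3 ≤ a → 2 * a ≤ b + 4
    → ∃[ H ] (SubgraphOf H (whole E)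
        × (IsK32 H
           ⊎ (KConnected 3 H × ∃[ h ] (h ∈ vy H × InternallyThreeConnected (deleteY H h)))))
lemma3p2 a b E semi 3≤a 2a≤b+4 with twins? E
... | yes (_ , _ , twins) = map₂ (map₂ inj₁) (twins⇒K32 E semi twins)
... | no noTwins = map₂ (map₂ inj₂) (no-twins⇒3-connected E semi noTwins nonempty tight)
  where
  open ≤-Reasoning
  nonempty : Nonempty (⊤ {b})
  nonempty = 1≤∣p∣⇒Nonempty (begin
    1        ≤⟨ s≤s z≤n ⟩
    2        ≤⟨ +-cancelʳ-≤ 4 2 b (≤-trans (*-monoʳ-≤ 2 3≤a) 2a≤b+4) ⟩
    b        ≡⟨ ∣⊤∣≡n b ⟨
    ∣ ⊤ {b} ∣ ∎)
  tight : Tight E 4 ⊤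
  tight = begin
    2 * ∣ N E ⊤ ∣   ≤⟨ *-monoʳ-≤ 2 (∣p∣≤n (N E ⊤)) ⟩
    2 * a           ≤⟨ 2a≤b+4 ⟩
    b + 4           ≡⟨ +-comm b 4 ⟩
    4 + b           ≡⟨ cong (4 +_) (∣⊤∣≡n b) ⟨
    4 + ∣ ⊤ {b} ∣   ∎
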